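{- Let $G$ be the root-fault hypertree $HT^{*}(3)$. Then $\gamma^{L}(G)=\gamma^{L}_t(G)=6$.
   Context: The hypertree $HT(n)$ has vertex set $\{1,\dots,2^{n+1}-1\}$, with the complete binary tree edges $\{x,2x\},\{x,2x+1\}$ (vertex $v$ at level $i$ iff $2^i\le v\le 2^{i+1}-1$) plus, for each level $i\ge1$, edges between level-$i$ vertices whose labels differ by $2^{i-1}$. The root-fault hypertree $HT^{*}(n)$ ($n\ge2$) is obtained from $HT(n)$ by deleting the root vertex $1$. A locating-dominating set is a set $S$ such that every vertex outside $S$ has a neighbor in $S$ and distinct $u,v\notin S$ satisfy $N(u)\cap S\ne N(v)\cap S$; a locating-total dominating set is a set $S$ such that every vertex of $G$ has a neighbor in $S$ and distinct $u,v\notin S$ satisfy $N(u)\cap S\ne N(v)\cap S$. $\gamma^{L}(G)$ and $\gamma^{L}_t(G)$ denote the respective minimum cardinalities. -}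

module Defs where

open import Data.Nat using (ℕ; suc; _+_; _*_; _∸_; _^_; _≤_; _<_)
open import Data.Product using (Σ; ∃; _×_)
open import Data.Sum using (_⊎_)
open import Data.List using (List; length)
open import Data.List.Membership.Propositional using (_∈_; _∉_)
open import Data.List.Relation.Unary.Unique.Propositional using (Unique)
open import Relation.Binary.PropositionalEquality using (_≡_; _≢_)
open import Relation.Nullary using (¬_)
open import Function.Bundles using (_⇔_)
open import Level using (0ℓ)

record Graph : Set₁ where
  field
    V   : ℕ → Set
    Adj : ℕ → ℕ → Set
open Graph public

-- vertex v lies at level i of the complete binary tree: 2^i ≤ v ≤ 2^(i+1) - 1
AtLevel : ℕ → ℕ → Set
AtLevel i v = 2 ^ i ≤ v × v < 2 ^ suc i

TreeEdge : ℕ → ℕ → Set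
TreeEdge u v = (v ≡ 2 * u ⊎ v ≡ 2 * u + 1) ⊎ (u ≡ 2 * v ⊎ u ≡ 2 * v + 1)

LevelEdge : ℕ → ℕ → Set
LevelEdge u v = ∃ λ i → 1 ≤ i × AtLevel i u × AtLevel i v
                  × (u + 2 ^ (i ∸ 1) ≡ v ⊎ v + 2 ^ (i ∸ 1) ≡ u)

HTVertex : ℕ → ℕ → Set
HTVertex n v = 1 ≤ v × v < 2 ^ suc n

HTAdj : ℕ → ℕ → ℕ → Set
HTAdj n u v = HTVertex n u × HTVertex n v × (TreeEdge u v ⊎ LevelEdge u v)

HT : ℕ → Graph
HT n = record { V = HTVertex n ; Adj = HTAdj n }

-- root-fault hypertree HT*(n): HT(n) minus the root vertex 1 (induced subgraph)
HTStarVertex : ℕ → ℕ → Set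
HTStarVertex n v = HTVertex n v × v ≢ 1

HTStar : ℕ → Graph
HTStar n = record
  { V   = HTStarVertex n
  ; Adj = λ u v → HTStarVertex n u × HTStarVertex n v × HTAdj n u v }

-- vertex subsets represented as duplicate-free lists of vertices
IsVertexSet : Graph → List ℕ → Set
IsVertexSet G S = Unique S × (∀ {w} → w ∈ S → V G w)

SameTrace : Graph → List ℕ → ℕ → ℕ → Set
SameTrace G S u v = ∀ {w} → w ∈ S → (Adj G u w ⇔ Adj G v w)

Locating : Graph → List ℕ → Set
Locating G S = ∀ u v → V G u → V G v → u ∉ S → v ∉ S → u ≢ v
               → ¬ SameTrace G S u v

IsLocatingDominating : Graph → List ℕ → Set
IsLocatingDominating G S =
  IsVertexSet G S
  × (∀ v → V G v → v ∉ S → ∃ λ w → w ∈ S × Adj G v w)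
  × Locating G S

IsLocatingTotalDominating : Graph → List ℕ → Set
IsLocatingTotalDominating G S =
  IsVertexSet G S
  × (∀ v → V G v → ∃ λ w → w ∈ S × Adj G v w)
  × Locating G S

MinCard : (List ℕ → Set) → ℕ → Set
MinCard P k = (∃ λ S → P S × length S ≡ k) × (∀ S → P S → k ≤ length S)

γL≡ : Graph → ℕ → Set
γL≡ G k = MinCard (IsLocatingDominating G) k

γLt≡ : Graph → ℕ → Set
γLt≡ G k = MinCard (IsLocatingTotalDominating G) k

-- HT*(3) has the fourteen vertices 2,…,15, so both numbers are settled by a
-- finite computation, which we organise as follows.
--   * Adjacency in HT(n) and HT*(n) is decidable for every n: a horizontal edge
--     inside HT(n) can only live on a level i ≤ n, so its level is a bounded search.
--   * A graph presented by a duplicate-free vertex list and correct adjacency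
--     lists admits list versions of "dominating" and "locating" whose quantifiers
--     range over lists only; these are decidable, imply the real notions for the
--     list itself, and follow from the real notions for every list containing S.
--   * A locating-dominating set S of size ≤ k yields, by filtering the vertex list,
--     a sublist with at most k elements (a duplicate-free list contained in S is no
--     longer than S) passing the list checks; so if no sublist of size ≤ k passes,
--     every locating-dominating set has more than k elements.
--   * For HT*(3) we give the adjacency lists, exhibit {2,3,8,9,10,15} (locating-
--     dominating) and {4,5,6,7,8,10} (locating-total dominating), and let the
--     decision procedures rule out all 3473 sublists of size ≤ 5.  Since a locating-
--     total dominating set is locating-dominating, both minima equal 6.
module Submission where

open import Defs
open import Data.Product using (_×_; _,_; proj₁; proj₂; ∃)
open import Data.Nat using (ℕ; zero; suc; _+_; _*_; _∸_; _^_; _≤_; _<_; z≤n; s≤s; s≤s⁻¹; _≟_; _≤?_; _<?_)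
open import Data.Nat.Properties using (anyUpTo?; allUpTo?; ^-monoʳ-≤; <⇒≱; ≮⇒≥; ≤-trans; module ≤-Reasoning)
open import Data.Bool using (true)
open import Data.Sum using (_⊎_)
open import Data.Empty using (⊥-elim)
open import Data.List using (List; []; _∷_; [_]; length; filter; map; _++_)
open import Data.List.Properties using (length-removeAt′)
open import Data.List.Membership.Propositional using (_∈_; _∉_; find; lose)
open import Data.List.Membership.Propositional.Properties using (∈-filter⁻; ∈-filter⁺; ∈-map⁺; ∈-++⁺ˡ; ∈-++⁺ʳ)
open import Data.List.Membership.DecPropositional _≟_ using (_∈?_)
open import Data.List.Relation.Binary.Subset.Propositional using (_⊆_)
open import Data.List.Relation.Unary.Any as Any using (Any; here; there; _─_; index)
open import Data.List.Relation.Unary.All as All using (All)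
open import Data.List.Relation.Unary.AllPairs using ([]; _∷_)
open import Data.List.Relation.Unary.Unique.Propositional using (Unique)
open import Data.List.Relation.Unary.Unique.Propositional.Properties using (filter⁺)
open import Data.List.Relation.Unary.Unique.DecPropositional _≟_ using (unique?)
open import Relation.Binary.PropositionalEquality using (_≡_; refl; sym; _≢_; ≢-sym)
open import Relation.Nullary using (¬_; Dec; yes; no)
open import Relation.Nullary.Decidable using (_×-dec_; _⊎-dec_; _→-dec_; ¬?; map′; does)
open import Relation.Unary using (Decidable)
open import Function using (_∘_)
open import Function.Bundles using (_⇔_; mk⇔; Equivalence)
open import Function.Construct.Composition using (_⇔-∘_)
open import Function.Construct.Symmetry using (⇔-sym)

∈-─ : ∀ {A : Set} {x y : A} {ys : List A} → y ∈ ys → (p : x ∈ ys) → y ≢ x → y ∈ (ys ─ p)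
∈-─ (here refl) (here refl) y≢x = ⊥-elim (y≢x refl)
∈-─ (there y∈ys) (here refl) _ = y∈ys
∈-─ (here refl) (there _) _ = here refl
∈-─ (there y∈ys) (there p) y≢x = there (∈-─ y∈ys p y≢x)

-- A duplicate-free list contained in ys is at most as long as ys: its head can
-- be removed from ys, and the tail is contained in what remains.
unique⊆⇒length≤ : ∀ {A : Set} {xs ys : List A} → Unique xs → xs ⊆ ys → length xs ≤ length ys
unique⊆⇒length≤ [] _ = z≤n
unique⊆⇒length≤ {xs = x ∷ xs} {ys} (x∉xs ∷ xs-unique) xs⊆ys = begin
  suc (length xs)        ≤⟨ s≤s (unique⊆⇒length≤ xs-unique xs⊆rest) ⟩
  suc (length (ys ─ x∈ys)) ≡⟨ sym (length-removeAt′ ys (index x∈ys)) ⟩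
  length ys              ∎
  where
  open ≤-Reasoning
  x∈ys : x ∈ ys
  x∈ys = xs⊆ys (here refl)
  xs⊆rest : xs ⊆ (ys ─ x∈ys)
  xs⊆rest y∈xs = ∈-─ (xs⊆ys (there y∈xs)) x∈ys (≢-sym (All.lookup x∉xs y∈xs))

sublistsUpTo : ∀ {A : Set} → ℕ → List A → List (List A)
sublistsUpTo k [] = [ [] ]
sublistsUpTo zero (x ∷ xs) = [ [] ]
sublistsUpTo (suc k) (x ∷ xs) = map (x ∷_) (sublistsUpTo k xs) ++ sublistsUpTo (suc k) xs

filter∈sublistsUpTo : ∀ {A : Set} {P : A → Set} (P? : Decidable P) k xs →
                      length (filter P? xs) ≤ k → filter P? xs ∈ sublistsUpTo k xs
filter∈sublistsUpTo P? k [] _ = here refl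
filter∈sublistsUpTo P? zero (x ∷ xs) short with P? x
filter∈sublistsUpTo P? zero (x ∷ xs) ()    | yes _
filter∈sublistsUpTo P? zero (x ∷ xs) short | no _ with filter P? xs
... | [] = here refl
filter∈sublistsUpTo P? (suc k) (x ∷ xs) short with P? x
... | yes _ = ∈-++⁺ˡ (∈-map⁺ (x ∷_) (filter∈sublistsUpTo P? k xs (s≤s⁻¹ short)))
... | no _ = ∈-++⁺ʳ (map (x ∷_) (sublistsUpTo k xs)) (filter∈sublistsUpTo P? (suc k) xs short)

_⇔-dec_ : ∀ {A B : Set} → Dec A → Dec B → Dec (A ⇔ B)
a? ⇔-dec b? = map′ (λ (to , from) → mk⇔ to from) (λ e → Equivalence.to e , Equivalence.from e)
                   ((a? →-dec b?) ×-dec (b? →-dec a?))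

-- A witness of a decision whose boolean part evaluates to true.  All finite
-- facts about HT*(3) are closed this way, by evaluating booleans only.
byDecision : ∀ {A : Set} (a? : Dec A) → does a? ≡ true → A
byDecision (yes a) _ = a

Dominating : Graph → List ℕ → Set
Dominating G S = ∀ v → V G v → v ∉ S → ∃ λ w → w ∈ S × Adj G v w

TotallyDominating : Graph → List ℕ → Set
TotallyDominating G S = ∀ v → V G v → ∃ λ w → w ∈ S × Adj G v w

ltd⇒ld : ∀ {G S} → IsLocatingTotalDominating G S → IsLocatingDominating G S
ltd⇒ld (vertexSet , totallyDominating , locating) =
  vertexSet , (λ v v∈G _ → totallyDominating v v∈G) , locating

record AdjacencyLists (G : Graph) : Set where
  field
    vertices        : List ℕ
    vertices-unique : Unique vertices
    vertex⇔         : ∀ {v} → V G v ⇔ v ∈ vertices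
    nbrs            : ℕ → List ℕ
    nbrs⇔           : ∀ {u w} → u ∈ vertices → Adj G u w ⇔ w ∈ nbrs u

module ListChecks {G : Graph} (L : AdjacencyLists G) where
  open AdjacencyLists L

  DominatesL : List ℕ → Set
  DominatesL T = All (λ v → v ∉ T → Any (_∈ nbrs v) T) vertices

  TotallyDominatesL : List ℕ → Set
  TotallyDominatesL T = All (λ v → Any (_∈ nbrs v) T) vertices

  SameTraceL : List ℕ → ℕ → ℕ → Set
  SameTraceL T u v = All (λ w → w ∈ nbrs u ⇔ w ∈ nbrs v) T

  LocatesL : List ℕ → Set
  LocatesL T = All (λ u → All (λ v → ¬ (u ∉ T × v ∉ T × u ≢ v × SameTraceL T u v)) vertices) vertices

  dominatesL? : ∀ T → Dec (DominatesL T)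
  dominatesL? T = All.all? (λ v → ¬? (v ∈? T) →-dec Any.any? (_∈? nbrs v) T) vertices

  totallyDominatesL? : ∀ T → Dec (TotallyDominatesL T)
  totallyDominatesL? T = All.all? (λ v → Any.any? (_∈? nbrs v) T) vertices

  locatesL? : ∀ T → Dec (LocatesL T)
  locatesL? T = All.all? (λ u → All.all? (λ v → ¬? (¬? (u ∈? T) ×-dec ¬? (v ∈? T) ×-dec ¬? (u ≟ v)
                  ×-dec All.all? (λ w → (w ∈? nbrs u) ⇔-dec (w ∈? nbrs v)) T)) vertices) vertices

  trace⇒traceL : ∀ {u v w} → u ∈ vertices → v ∈ vertices →
                 (Adj G u w ⇔ Adj G v w) → (w ∈ nbrs u ⇔ w ∈ nbrs v)
  trace⇒traceL u∈V v∈V same = nbrs⇔ v∈V ⇔-∘ (same ⇔-∘ ⇔-sym (nbrs⇔ u∈V))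

  traceL⇒trace : ∀ {u v w} → u ∈ vertices → v ∈ vertices →
                 (w ∈ nbrs u ⇔ w ∈ nbrs v) → (Adj G u w ⇔ Adj G v w)
  traceL⇒trace u∈V v∈V same = ⇔-sym (nbrs⇔ v∈V) ⇔-∘ (same ⇔-∘ nbrs⇔ u∈V)

  dominating : ∀ {S} → DominatesL S → Dominating G S
  dominating check v v∈G v∉S =
    let v∈V = Equivalence.to vertex⇔ v∈G
        w , w∈S , w∈nbrs = find (All.lookup check v∈V v∉S)
    in w , w∈S , Equivalence.from (nbrs⇔ v∈V) w∈nbrs

  totallyDominating : ∀ {S} → TotallyDominatesL S → TotallyDominating G S
  totallyDominating check v v∈G =
    let v∈V = Equivalence.to vertex⇔ v∈G
        w , w∈S , w∈nbrs = find (All.lookup check v∈V)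
    in w , w∈S , Equivalence.from (nbrs⇔ v∈V) w∈nbrs

  locating : ∀ {S} → LocatesL S → Locating G S
  locating check u v u∈G v∈G u∉S v∉S u≢v same =
    All.lookup (All.lookup check u∈V) v∈V
      (u∉S , v∉S , u≢v , All.tabulate (λ w∈S → trace⇒traceL u∈V v∈V (same w∈S)))
    where
    u∈V = Equivalence.to vertex⇔ u∈G
    v∈V = Equivalence.to vertex⇔ v∈G

  -- Completeness, in the stronger form that the checks succeed on every list
  -- containing S (domination and location are inherited by supersets).
  dominatesL-⊇ : ∀ {S T} → S ⊆ T → Dominating G S → DominatesL T
  dominatesL-⊇ S⊆T dom = All.tabulate λ {v} v∈V v∉T →
    let w , w∈S , adj = dom v (Equivalence.from vertex⇔ v∈V) (v∉T ∘ S⊆T)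
    in lose (S⊆T w∈S) (Equivalence.to (nbrs⇔ v∈V) adj)

  locatesL-⊇ : ∀ {S T} → S ⊆ T → Locating G S → LocatesL T
  locatesL-⊇ S⊆T loc = All.tabulate λ {u} u∈V → All.tabulate λ {v} v∈V (u∉T , v∉T , u≢v , same) →
    loc u v (Equivalence.from vertex⇔ u∈V) (Equivalence.from vertex⇔ v∈V)
            (u∉T ∘ S⊆T) (v∉T ∘ S⊆T) u≢v
            (λ w∈S → traceL⇒trace u∈V v∈V (All.lookup same (S⊆T w∈S)))

  locatingDominating : ∀ {S} → Unique S → All (_∈ vertices) S →
                       DominatesL S → LocatesL S → IsLocatingDominating G S
  locatingDominating S-unique S⊆V dom loc =
    (S-unique , Equivalence.from vertex⇔ ∘ All.lookup S⊆V) , dominating dom , locating loc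

  locatingTotalDominating : ∀ {S} → Unique S → All (_∈ vertices) S →
                            TotallyDominatesL S → LocatesL S → IsLocatingTotalDominating G S
  locatingTotalDominating S-unique S⊆V tdom loc =
    (S-unique , Equivalence.from vertex⇔ ∘ All.lookup S⊆V) , totallyDominating tdom , locating loc

  -- If no sublist of the vertex list with at most k elements passes the checks,
  -- every locating-dominating set has more than k elements: the vertices of S,
  -- listed in the order of the vertex list, would be such a sublist.
  locatingDominating-lowerBound :
    ∀ k → All (λ T → ¬ (DominatesL T × LocatesL T)) (sublistsUpTo k vertices) →
    ∀ S → IsLocatingDominating G S → k < length S
  locatingDominating-lowerBound k none S ((_ , S⊆G) , dom , loc) with k <? length S
  ... | yes k<|S| = k<|S|
  ... | no k≮|S| = ⊥-elim (All.lookup none R∈sublists (dominatesL-⊇ S⊆R dom , locatesL-⊇ S⊆R loc))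
    where
    R : List ℕ
    R = filter (_∈? S) vertices
    R⊆S : R ⊆ S
    R⊆S w∈R = proj₂ (∈-filter⁻ (_∈? S) {xs = vertices} w∈R)
    S⊆R : S ⊆ R
    S⊆R w∈S = ∈-filter⁺ (_∈? S) (Equivalence.to vertex⇔ (S⊆G w∈S)) w∈S
    |R|≤k : length R ≤ k
    |R|≤k = ≤-trans (unique⊆⇒length≤ (filter⁺ (_∈? S) vertices-unique) R⊆S) (≮⇒≥ k≮|S|)
    R∈sublists : R ∈ sublistsUpTo k vertices
    R∈sublists = filter∈sublistsUpTo (_∈? S) k vertices |R|≤k

LevelEdgeAt : ℕ → ℕ → ℕ → Set
LevelEdgeAt u v i = 1 ≤ i × AtLevel i u × AtLevel i v × (u + 2 ^ (i ∸ 1) ≡ v ⊎ v + 2 ^ (i ∸ 1) ≡ u)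

atLevel? : ∀ i v → Dec (AtLevel i v)
atLevel? i v = (2 ^ i ≤? v) ×-dec (v <? 2 ^ suc i)

levelEdgeAt? : ∀ u v i → Dec (LevelEdgeAt u v i)
levelEdgeAt? u v i = (1 ≤? i) ×-dec atLevel? i u ×-dec atLevel? i v
                     ×-dec ((u + 2 ^ (i ∸ 1) ≟ v) ⊎-dec (v + 2 ^ (i ∸ 1) ≟ u))

levelBound : ∀ {n i u} → 2 ^ i ≤ u → u < 2 ^ suc n → i < suc n
levelBound {n} {i} 2^i≤u u<2^n+1 with i <? suc n
... | yes i<n+1 = i<n+1
... | no i≮n+1 = ⊥-elim (<⇒≱ u<2^n+1 (≤-trans (^-monoʳ-≤ 2 (≮⇒≥ i≮n+1)) 2^i≤u))

-- Hence the level of a horizontal edge at a vertex of HT(n) is a bounded search.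
levelEdge? : ∀ n u v → u < 2 ^ suc n → Dec (LevelEdge u v)
levelEdge? n u v u<2^n+1 =
  map′ (λ (i , _ , edge) → i , edge)
       (λ (i , edge) → i , levelBound (proj₁ (proj₁ (proj₂ edge))) u<2^n+1 , edge)
       (anyUpTo? (levelEdgeAt? u v) (suc n))

treeEdge? : ∀ u v → Dec (TreeEdge u v)
treeEdge? u v = ((v ≟ 2 * u) ⊎-dec (v ≟ 2 * u + 1)) ⊎-dec ((u ≟ 2 * v) ⊎-dec (u ≟ 2 * v + 1))

htVertex? : ∀ n v → Dec (HTVertex n v)
htVertex? n v = (1 ≤? v) ×-dec (v <? 2 ^ suc n)

htAdj? : ∀ n u v → Dec (HTAdj n u v)
htAdj? n u v with htVertex? n u
... | no u∉HT = no (u∉HT ∘ proj₁)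
... | yes u∈HT = map′ (u∈HT ,_) proj₂
                   (htVertex? n v ×-dec (treeEdge? u v ⊎-dec levelEdge? n u v (proj₂ u∈HT)))

htStarVertex? : ∀ n v → Dec (HTStarVertex n v)
htStarVertex? n v = htVertex? n v ×-dec ¬? (v ≟ 1)

htStarAdj? : ∀ n u v → Dec (Adj (HTStar n) u v)
htStarAdj? n u v = htStarVertex? n u ×-dec htStarVertex? n v ×-dec htAdj? n u v

ht3Vertices : List ℕ
ht3Vertices = 2 ∷ 3 ∷ 4 ∷ 5 ∷ 6 ∷ 7 ∷ 8 ∷ 9 ∷ 10 ∷ 11 ∷ 12 ∷ 13 ∷ 14 ∷ 15 ∷ []

-- Level 1: 2,3; level 2: 4–7; level 3: 8–15.  Tree edges to the children and
-- horizontal edges to the vertex 2^(i-1) apart on the same level.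
ht3Nbrs : ℕ → List ℕ
ht3Nbrs 2  = 3 ∷ 4 ∷ 5 ∷ []
ht3Nbrs 3  = 2 ∷ 6 ∷ 7 ∷ []
ht3Nbrs 4  = 2 ∷ 6 ∷ 8 ∷ 9 ∷ []
ht3Nbrs 5  = 2 ∷ 7 ∷ 10 ∷ 11 ∷ []
ht3Nbrs 6  = 3 ∷ 4 ∷ 12 ∷ 13 ∷ []
ht3Nbrs 7  = 3 ∷ 5 ∷ 14 ∷ 15 ∷ []
ht3Nbrs 8  = 4 ∷ 12 ∷ []
ht3Nbrs 9  = 4 ∷ 13 ∷ []
ht3Nbrs 10 = 5 ∷ 14 ∷ []
ht3Nbrs 11 = 5 ∷ 15 ∷ []
ht3Nbrs 12 = 6 ∷ 8 ∷ []
ht3Nbrs 13 = 6 ∷ 9 ∷ []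
ht3Nbrs 14 = 7 ∷ 10 ∷ []
ht3Nbrs 15 = 7 ∷ 11 ∷ []
ht3Nbrs _  = []

-- The vertex list is correct; as vertices of HT*(3) lie below 2^4, both
-- directions are finite checks.
ht3-vertex⇔ : ∀ {v} → HTStarVertex 3 v ⇔ v ∈ ht3Vertices
ht3-vertex⇔ = mk⇔ (λ v∈G → listed (proj₂ (proj₁ v∈G)) v∈G) (All.lookup allVertices)
  where
  listed : ∀ {v} → v < 2 ^ suc 3 → HTStarVertex 3 v → v ∈ ht3Vertices
  listed = byDecision (allUpTo? (λ v → htStarVertex? 3 v →-dec v ∈? ht3Vertices) (2 ^ suc 3)) refl
  allVertices : All (HTStarVertex 3) ht3Vertices
  allVertices = byDecision (All.all? (htStarVertex? 3) ht3Vertices) refl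

-- The table lists exactly the neighbours; every neighbour is a vertex, so
-- completeness only has to be checked over pairs of vertices.
ht3-nbrs⇔ : ∀ {u w} → u ∈ ht3Vertices → Adj (HTStar 3) u w ⇔ w ∈ ht3Nbrs u
ht3-nbrs⇔ u∈V = mk⇔ (λ adj → All.lookup (All.lookup complete u∈V) (w∈V adj) adj)
                    (All.lookup (All.lookup sound u∈V))
  where
  w∈V : ∀ {u w} → Adj (HTStar 3) u w → w ∈ ht3Vertices
  w∈V adj = Equivalence.to ht3-vertex⇔ (proj₁ (proj₂ adj))
  complete : All (λ u → All (λ w → Adj (HTStar 3) u w → w ∈ ht3Nbrs u) ht3Vertices) ht3Vertices
  complete = byDecision (All.all? (λ u → All.all? (λ w → htStarAdj? 3 u w →-dec w ∈? ht3Nbrs u)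
                                                  ht3Vertices) ht3Vertices) refl
  sound : All (λ u → All (Adj (HTStar 3) u) (ht3Nbrs u)) ht3Vertices
  sound = byDecision (All.all? (λ u → All.all? (htStarAdj? 3 u) (ht3Nbrs u)) ht3Vertices) refl

ht3 : AdjacencyLists (HTStar 3)
ht3 = record
  { vertices        = ht3Vertices
  ; vertices-unique = byDecision (unique? ht3Vertices) refl
  ; vertex⇔         = ht3-vertex⇔
  ; nbrs            = ht3Nbrs
  ; nbrs⇔           = ht3-nbrs⇔
  }

open ListChecks ht3

ldSet : List ℕ
ldSet = 2 ∷ 3 ∷ 8 ∷ 9 ∷ 10 ∷ 15 ∷ []

ltdSet : List ℕ
ltdSet = 4 ∷ 5 ∷ 6 ∷ 7 ∷ 8 ∷ 10 ∷ []

ldSet-locatingDominating : IsLocatingDominating (HTStar 3) ldSet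
ldSet-locatingDominating =
  locatingDominating (byDecision (unique? ldSet) refl)
                     (byDecision (All.all? (_∈? ht3Vertices) ldSet) refl)
                     (byDecision (dominatesL? ldSet) refl) (byDecision (locatesL? ldSet) refl)

ltdSet-locatingTotalDominating : IsLocatingTotalDominating (HTStar 3) ltdSet
ltdSet-locatingTotalDominating =
  locatingTotalDominating (byDecision (unique? ltdSet) refl)
                          (byDecision (All.all? (_∈? ht3Vertices) ltdSet) refl)
                          (byDecision (totallyDominatesL? ltdSet) refl) (byDecision (locatesL? ltdSet) refl)

noSmallLocatingDominating : All (λ T → ¬ (DominatesL T × LocatesL T)) (sublistsUpTo 5 ht3Vertices)
noSmallLocatingDominating =
  byDecision (All.all? (λ T → ¬? (dominatesL? T ×-dec locatesL? T)) (sublistsUpTo 5 ht3Vertices)) refl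

lemma5 : γL≡ (HTStar 3) 6 × γLt≡ (HTStar 3) 6
lemma5 = ((ldSet , ldSet-locatingDominating , refl) , atLeast6)
       , ((ltdSet , ltdSet-locatingTotalDominating , refl) , λ S → atLeast6 S ∘ ltd⇒ld)
  where
  atLeast6 : ∀ S → IsLocatingDominating (HTStar 3) S → 6 ≤ length S
  atLeast6 = locatingDominating-lowerBound 5 noSmallLocatingDominating
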